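{- There exists a deterministic, single-outputting p-filter $F$, all of whose states are reachable from its initial state, with the following property. Let $F^\star$ be any deterministic p-filter that output simulates $F$ and has the minimum number of states among all deterministic p-filters that output simulate $F$. Then the relation on $V(F)$ induced by $F^\star$ is not an equivalence relation.
   Context: A p-filter is a tuple $F=(V,V_0,Y,\tau,C,c)$ with the following components: $V$ is a finite set of states; $\emptyset\neq V_0\subseteq V$ is the set of initial states; $Y$ is a set of observations; $\tau:V\times V\to 2^Y$ is the transition function; $C$ is an output space; and $c:V\to 2^C\setminus\{\emptyset\}$ is the output function. For $s=y_1\cdots y_n\in Y^*$ and $w_0\in V$, let $V_F(w_0,s)$ be the set of states $w_n$ for which there exist $w_1,\dots,w_n\in V$ with $y_i\in\tau(w_{i-1},w_i)$ for all $i$. Let $V_F(s)=\bigcup_{v_0\in V_0}V_F(v_0,s)$. The language $L(F)$ is the set of strings $s$ with $V_F(s)\neq\emptyset$. Let $C_F(s)=\bigcup_{v\in V_F(s)}c(v)$. For a state $v$, let $S_F(v)=\{s: v\in V_F(s)\}$ be the set of strings reaching $v$. $F'$ output simulates $F$ if, for all $s\in L(F)$, $C_{F'}(s)\neq\emptyset$ and $C_{F'}(s)\subseteq C_F(s)$. $F$ is deterministic if $|V_0|=1$ and, for all $v_1,v_2,v_3$ with $v_2\neq v_3$, $\tau(v_1,v_2)\cap\tau(v_1,v_3)=\emptyset$. $F$ is single-outputting if $|c(v)|=1$ for all $v$. If $F'$ output simulates $F$, the relation induced by $F'$ is $R\subseteq V(F)\times V(F)$, where $(v,w)\in R$ iff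 there is $v'\in V(F')$ with $S_F(v)\cap S_{F'}(v')\neq\emptyset$ and $S_F(w)\cap S_{F'}(v')\neq\emptyset$. -}

module Defs where

open import Data.Nat using (ℕ; _≤_)
open import Data.Fin using (Fin)
open import Data.List using (List; []; _∷_)
open import Data.Product using (Σ; ∃; _×_; _,_)
open import Relation.Binary.PropositionalEquality using (_≡_; _≢_)
open import Relation.Nullary using (¬_)
open import Data.Empty using (⊥)

-- A p-filter with observation set Y and output space C.
-- States are Fin n (a finite set of n states); subsets are predicates.
record PFilter (Y C : Set) : Set₁ where
  field
    n       : ℕ
    init    : Fin n → Set
    initNE  : ∃ λ v → init v
    τ       : Fin n → Fin n → Y → Set
    out     : Fin n → C → Set
    outNE   : ∀ v → ∃ λ c → out v c

open PFilter public

module _ {Y C : Set} (F : PFilter Y C) where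

  data Reach : Fin (n F) → List Y → Fin (n F) → Set where
    done : ∀ {w} → Reach w [] w
    step : ∀ {w₀ w₁ y s w} → τ F w₀ w₁ y → Reach w₁ s w → Reach w₀ (y ∷ s) w

  VF : List Y → Fin (n F) → Set
  VF s v = ∃ λ v₀ → init F v₀ × Reach v₀ s v

  InL : List Y → Set
  InL s = ∃ λ v → VF s v

  CF : List Y → C → Set
  CF s c = ∃ λ v → VF s v × out F v c

  SF : Fin (n F) → List Y → Set
  SF v s = VF s v

  Deterministic : Set
  Deterministic =
    (∃ λ v₀ → init F v₀ × (∀ v → init F v → v ≡ v₀)) ×
    (∀ v₁ v₂ v₃ y → v₂ ≢ v₃ → τ F v₁ v₂ y → τ F v₁ v₃ y → ⊥)

  SingleOutputting : Set
  SingleOutputting = ∀ v → ∃ λ c → out F v c × (∀ c' → out F v c' → c' ≡ c)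

  AllReachable : Set
  AllReachable = ∀ v → ∃ λ s → VF s v

OutputSimulates : {Y C : Set} → PFilter Y C → PFilter Y C → Set
OutputSimulates F' F =
  ∀ s → InL F s → (∃ λ c → CF F' s c) × (∀ c → CF F' s c → CF F s c)

MinDetSim : {Y C : Set} → PFilter Y C → PFilter Y C → Set₁
MinDetSim F' F =
  Deterministic F' × OutputSimulates F' F ×
  (∀ (G : PFilter _ _) → Deterministic G → OutputSimulates G F → n F' ≤ n G)

Induced : {Y C : Set} (F F' : PFilter Y C) → Fin (n F) → Fin (n F) → Set
Induced F F' v w =
  ∃ λ v' → (∃ λ s → SF F v s × SF F' v' s) × (∃ λ s → SF F w s × SF F' v' s)

-- F has red states p, q, r, a green state g and a blue state h, and the four-state
-- deterministic filter G simulates it by merging q with p after some histories and with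
-- r after others.  Conversely, let H be deterministic, simulate F, and induce an
-- equivalence.  States of different colours are never merged, nor are p and r (reading
-- a, they lead to g and h).  If q is merged with p, determinism merges its b-successor r
-- with q, hence with p; if q is merged with r, then also bc and bbc are merged, so p ~ q
-- ~ r, and transitivity merges p and r.  So H has at least five states, one more than G.
module Submission where

open import Defs
open import Data.Product using (Σ; _×_; ∃; _,_; proj₁; proj₂)
open import Relation.Nullary using (¬_; yes; no)
open import Relation.Binary.Structures using (IsEquivalence)
open import Data.Nat using (_≤_; s≤s)
open import Data.Nat.Properties using (≮⇒≥; ≤-trans; <-irrefl)
open import Data.Fin using (Fin; zero; suc; _<_; _≟_)
open import Data.Fin.Properties using (pigeonhole)
open import Data.List using (List; []; _∷_; _++_)
open import Relation.Binary.PropositionalEquality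
open import Data.Empty using (⊥; ⊥-elim)

module _ {Y C : Set} (H : PFilter Y C) where

  Reach-++ : ∀ {x s t y z} → Reach H x s y → Reach H y t z → Reach H x (s ++ t) z
  Reach-++ done r = r
  Reach-++ (step e r₁) r₂ = step e (Reach-++ r₁ r₂)

  Reach-++⁻ : ∀ {x} s {t z} → Reach H x (s ++ t) z → ∃ λ y → Reach H x s y × Reach H y t z
  Reach-++⁻ [] r = _ , done , r
  Reach-++⁻ (_ ∷ s) (step e r) with Reach-++⁻ s r
  ... | y , r₁ , r₂ = y , step e r₁ , r₂

  VF-snoc : ∀ {s x y o} → VF H s x → τ H x y o → VF H (s ++ o ∷ []) y
  VF-snoc (x₀ , i , r) e = x₀ , i , Reach-++ r (step e done)

  module _ (det : Deterministic H) where

    Reach-functional : ∀ {x s y y′} → Reach H x s y → Reach H x s y′ → y ≡ y′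
    Reach-functional done done = refl
    Reach-functional (step {w₁ = x₁} e r) (step {w₁ = x₁′} e′ r′) with x₁ ≟ x₁′
    ... | yes refl = Reach-functional r r′
    ... | no x₁≢x₁′ = ⊥-elim (proj₂ det _ _ _ _ x₁≢x₁′ e e′)

    VF-functional : ∀ {s x y} → VF H s x → VF H s y → x ≡ y
    VF-functional (x₀ , i , r) (y₀ , j , r′) with proj₁ det
    ... | _ , _ , unique with trans (unique x₀ i) (sym (unique y₀ j))
    ... | refl = Reach-functional r r′

    VF-right-congruent : ∀ s s′ t {x y y′} → VF H s x → VF H s′ x →
                         VF H (s ++ t) y → VF H (s′ ++ t) y′ → y ≡ y′
    VF-right-congruent s s′ t vs vs′ (x₀ , i , r) (x₀′ , i′ , r′)
      with Reach-++⁻ s r | Reach-++⁻ s′ r′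
    ... | _ , r₁ , r₂ | _ , r₁′ , r₂′
      with VF-functional vs (x₀ , i , r₁) | VF-functional vs′ (x₀′ , i′ , r₁′)
    ... | refl | refl = Reach-functional r₂ r₂′

module _ {Y C : Set} {F H : PFilter Y C} (sim : OutputSimulates H F) where

  simulator-reaches : ∀ {s v} → VF F s v → ∃ λ x → VF H s x
  simulator-reaches {s} {v} vf with proj₁ (sim s (v , vf))
  ... | _ , x , vx , _ = x , vx

  simulated-output : Deterministic F → ∀ {s v x c} → VF F s v → VF H s x → out H x c → out F v c
  simulated-output detF {s} {v} {x} {c} vf vx o with proj₂ (sim s (v , vf)) c (x , vx , o)
  ... | _ , vf′ , o′ = subst (λ u → out F u c) (sym (VF-functional F detF vf vf′)) o′

simulation⇒OutputSimulates :
  {Y C : Set} {F G : PFilter Y C} → Deterministic G → (R : Fin (n F) → Fin (n G) → Set) →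
  (∀ {v₀} → init F v₀ → ∃ λ w₀ → init G w₀ × R v₀ w₀) →
  (∀ {v v′ w o} → R v w → τ F v v′ o → ∃ λ w′ → τ G w w′ o × R v′ w′) →
  (∀ {v w c} → R v w → out G w c → out F v c) →
  OutputSimulates G F
simulation⇒OutputSimulates {F = F} {G} detG R R-init R-step R-out s (v , v₀ , i , r)
  with R-init i
... | w₀ , j , Rv₀w₀ with lift Rv₀w₀ r
  where
  lift : ∀ {v w s v′} → R v w → Reach F v s v′ → ∃ λ w′ → Reach G w s w′ × R v′ w′
  lift Rvw done = _ , done , Rvw
  lift Rvw (step e r) with R-step Rvw e
  ... | _ , e′ , Rv₁w₁ with lift Rv₁w₁ r
  ... | w′ , r′ , Rv′w′ = w′ , step e′ r′ , Rv′w′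
... | w , r′ , Rvw with outNE G w
... | c , o = (c , w , (w₀ , j , r′) , o) ,
              λ c′ → λ { (w′ , vf′ , o′) →
                v , (v₀ , i , r) ,
                R-out Rvw (subst (λ u → out G u c′) (VF-functional G detG vf′ (w₀ , j , r′)) o′) }

data Observation : Set where
  a b c : Observation

data Colour : Set where
  red green blue : Colour

pattern p = zero
pattern q = suc zero
pattern r = suc (suc zero)
pattern g = suc (suc (suc zero))
pattern h = suc (suc (suc (suc zero)))

data EdgeF : Fin 5 → Fin 5 → Observation → Set where
  p-a : EdgeF p g a
  p-b : EdgeF p q b
  q-b : EdgeF q r b
  q-c : EdgeF q p c
  r-a : EdgeF r h a
  r-c : EdgeF r q c

colourF : Fin 5 → Colour
colourF p = red
colourF q = red
colourF r = red
colourF g = green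
colourF h = blue

F : PFilter Observation Colour
F = record { n = 5 ; init = _≡ p ; initNE = p , refl ; τ = EdgeF
           ; out = λ v col → colourF v ≡ col ; outNE = λ v → colourF v , refl }

deterministic-F : Deterministic F
deterministic-F = (p , refl , λ _ i → i) , edges-disjoint
  where
  edges-disjoint : ∀ v₁ v₂ v₃ o → v₂ ≢ v₃ → EdgeF v₁ v₂ o → EdgeF v₁ v₃ o → ⊥
  edges-disjoint _ _ _ _ v₂≢v₃ p-a p-a = v₂≢v₃ refl
  edges-disjoint _ _ _ _ v₂≢v₃ p-b p-b = v₂≢v₃ refl
  edges-disjoint _ _ _ _ v₂≢v₃ q-b q-b = v₂≢v₃ refl
  edges-disjoint _ _ _ _ v₂≢v₃ q-c q-c = v₂≢v₃ refl
  edges-disjoint _ _ _ _ v₂≢v₃ r-a r-a = v₂≢v₃ refl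
  edges-disjoint _ _ _ _ v₂≢v₃ r-c r-c = v₂≢v₃ refl

single-outputting-F : SingleOutputting F
single-outputting-F v = colourF v , refl , λ _ o → sym o

all-reachable-F : AllReachable F
all-reachable-F p = [] , p , refl , done
all-reachable-F q = b ∷ [] , p , refl , step p-b done
all-reachable-F r = b ∷ b ∷ [] , p , refl , step p-b (step q-b done)
all-reachable-F g = a ∷ [] , p , refl , step p-a done
all-reachable-F h = b ∷ b ∷ a ∷ [] , p , refl , step p-b (step q-b (step r-a done))

data EdgeG : Fin 4 → Fin 4 → Observation → Set where
  pq-a : EdgeG zero (suc (suc zero)) a
  pq-b : EdgeG zero (suc zero) b
  pq-c : EdgeG zero zero c
  qr-a : EdgeG (suc zero) (suc (suc (suc zero))) a
  qr-b : EdgeG (suc zero) (suc zero) b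
  qr-c : EdgeG (suc zero) zero c

colourG : Fin 4 → Colour
colourG zero = red
colourG (suc zero) = red
colourG (suc (suc zero)) = green
colourG (suc (suc (suc zero))) = blue

G : PFilter Observation Colour
G = record { n = 4 ; init = _≡ zero ; initNE = zero , refl ; τ = EdgeG
           ; out = λ w col → colourG w ≡ col ; outNE = λ w → colourG w , refl }

deterministic-G : Deterministic G
deterministic-G = (zero , refl , λ _ i → i) , edges-disjoint
  where
  edges-disjoint : ∀ w₁ w₂ w₃ o → w₂ ≢ w₃ → EdgeG w₁ w₂ o → EdgeG w₁ w₃ o → ⊥
  edges-disjoint _ _ _ _ w₂≢w₃ pq-a pq-a = w₂≢w₃ refl
  edges-disjoint _ _ _ _ w₂≢w₃ pq-b pq-b = w₂≢w₃ refl
  edges-disjoint _ _ _ _ w₂≢w₃ pq-c pq-c = w₂≢w₃ refl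
  edges-disjoint _ _ _ _ w₂≢w₃ qr-a qr-a = w₂≢w₃ refl
  edges-disjoint _ _ _ _ w₂≢w₃ qr-b qr-b = w₂≢w₃ refl
  edges-disjoint _ _ _ _ w₂≢w₃ qr-c qr-c = w₂≢w₃ refl

data Merge : Fin 5 → Fin 4 → Set where
  p↦pq : Merge p zero
  q↦pq : Merge q zero
  q↦qr : Merge q (suc zero)
  r↦qr : Merge r (suc zero)
  g↦g  : Merge g (suc (suc zero))
  h↦h  : Merge h (suc (suc (suc zero)))

G-simulates-F : OutputSimulates G F
G-simulates-F = simulation⇒OutputSimulates deterministic-G Merge
  (λ { refl → zero , refl , p↦pq }) merge-step merge-colour
  where
  merge-step : ∀ {v v′ w o} → Merge v w → EdgeF v v′ o → ∃ λ w′ → EdgeG w w′ o × Merge v′ w′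
  merge-step p↦pq p-a = _ , pq-a , g↦g
  merge-step p↦pq p-b = _ , pq-b , q↦qr
  merge-step q↦pq q-b = _ , pq-b , r↦qr
  merge-step q↦pq q-c = _ , pq-c , p↦pq
  merge-step q↦qr q-b = _ , qr-b , r↦qr
  merge-step q↦qr q-c = _ , qr-c , p↦pq
  merge-step r↦qr r-a = _ , qr-a , h↦h
  merge-step r↦qr r-c = _ , qr-c , q↦pq

  merge-colour : ∀ {v w col} → Merge v w → colourG w ≡ col → colourF v ≡ col
  merge-colour p↦pq e = e
  merge-colour q↦pq e = e
  merge-colour q↦qr e = e
  merge-colour r↦qr e = e
  merge-colour g↦g e = e
  merge-colour h↦h e = e

module _ (H : PFilter Observation Colour) (deterministic-H : Deterministic H)
         (H-simulates-F : OutputSimulates H F) where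

  shared-state⇒same-colour : ∀ {s t x v w} → VF H s x → VF F s v → VF H t x → VF F t w →
                             colourF v ≡ colourF w
  shared-state⇒same-colour {x = x} vs fs vt ft with outNE H x
  ... | col , o = trans (simulated-output H-simulates-F deterministic-F fs vs o)
                        (sym (simulated-output H-simulates-F deterministic-F ft vt o))

  p-r-never-merged : ∀ {s t x} → VF H s x → VF H t x → VF F s p → VF F t r → ⊥
  p-r-never-merged {s} {t} vs vt fs ft
    with simulator-reaches H-simulates-F (VF-snoc F fs p-a)
       | simulator-reaches H-simulates-F (VF-snoc F ft r-a)
  ... | _ , vsa | _ , vta
    with VF-right-congruent H deterministic-H s t (a ∷ []) vs vt vsa vta
  ... | refl with shared-state⇒same-colour vsa (VF-snoc F fs p-a) vta (VF-snoc F ft r-a)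
  ... | ()

  word : Fin 5 → List Observation
  word v = proj₁ (all-reachable-F v)

  state : Fin 5 → Fin (n H)
  state v = proj₁ (simulator-reaches H-simulates-F (proj₂ (all-reachable-F v)))

  state-reached : ∀ v → VF H (word v) (state v)
  state-reached v = proj₂ (simulator-reaches H-simulates-F (proj₂ (all-reachable-F v)))

  word-reaches : ∀ v → VF F (word v) v
  word-reaches v = proj₂ (all-reachable-F v)

  state-colour : ∀ {v w} → state v ≡ state w → colourF v ≡ colourF w
  state-colour {v} {w} e =
    shared-state⇒same-colour (subst (VF H _) e (state-reached v)) (word-reaches v)
                             (state-reached w) (word-reaches w)

  state-p≢state-r : state p ≢ state r
  state-p≢state-r e = p-r-never-merged (subst (VF H _) e (state-reached p)) (state-reached r)
                                       (word-reaches p) (word-reaches r)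

  state-p≢state-q : state p ≢ state q
  state-p≢state-q e = state-p≢state-r (trans e state-q≡state-r)
    where
    state-q≡state-r : state q ≡ state r
    state-q≡state-r = VF-right-congruent H deterministic-H [] (b ∷ []) (b ∷ [])
      (state-reached p) (subst (VF H _) (sym e) (state-reached q)) (state-reached q) (state-reached r)

  state-q≢state-r : IsEquivalence (Induced F H) → state q ≢ state r
  state-q≢state-r equivalence e with IsEquivalence.trans equivalence p~q q~r
    where
    bb-reaches-q-state : VF H (b ∷ b ∷ []) (state q)
    bb-reaches-q-state = subst (VF H _) (sym e) (state-reached r)

    bc-reaches-p : VF F (b ∷ c ∷ []) p
    bc-reaches-p = p , refl , step p-b (step q-c done)

    bbc-reaches-q : VF F (b ∷ b ∷ c ∷ []) q
    bbc-reaches-q = p , refl , step p-b (step q-b (step r-c done))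

    p~q : Induced F H p q
    p~q with simulator-reaches H-simulates-F bc-reaches-p
           | simulator-reaches H-simulates-F bbc-reaches-q
    ... | x , vx | x′ , vx′
      with VF-right-congruent H deterministic-H (b ∷ []) (b ∷ b ∷ []) (c ∷ [])
             (state-reached q) bb-reaches-q-state vx vx′
    ... | refl = x , (_ , bc-reaches-p , vx) , (_ , bbc-reaches-q , vx′)

    q~r : Induced F H q r
    q~r = state q , (_ , word-reaches q , state-reached q) , (_ , word-reaches r , bb-reaches-q-state)
  ... | _ , (_ , fs , vs) , (_ , ft , vt) = p-r-never-merged vs vt fs ft

  colour-apart : ∀ {v w} → colourF v ≢ colourF w → state v ≢ state w
  colour-apart colours-differ e = colours-differ (state-colour e)

  distinct-states : IsEquivalence (Induced F H) → ∀ {v w} → v < w → state v ≢ state w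
  distinct-states _           {w = zero} ()
  distinct-states _           {p} {q} _ = state-p≢state-q
  distinct-states _           {p} {r} _ = state-p≢state-r
  distinct-states _           {p} {g} _ = colour-apart λ ()
  distinct-states _           {p} {h} _ = colour-apart λ ()
  distinct-states equivalence {q} {r} _ = state-q≢state-r equivalence
  distinct-states _           {q} {g} _ = colour-apart λ ()
  distinct-states _           {q} {h} _ = colour-apart λ ()
  distinct-states _           {r} {g} _ = colour-apart λ ()
  distinct-states _           {r} {h} _ = colour-apart λ ()
  distinct-states _           {g} {h} _ = colour-apart λ ()
  distinct-states _ {suc _} {q} (s≤s ())
  distinct-states _ {suc (suc _)} {r} (s≤s (s≤s ()))
  distinct-states _ {suc (suc (suc _))} {g} (s≤s (s≤s (s≤s ())))
  distinct-states _ {suc (suc (suc (suc _)))} {h} (s≤s (s≤s (s≤s (s≤s ()))))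

  at-least-five-states : IsEquivalence (Induced F H) → 5 ≤ n H
  at-least-five-states equivalence = ≮⇒≥ λ fewer-states →
    let v , w , v<w , same-state = pigeonhole fewer-states state
    in distinct-states equivalence v<w same-state

lemma4 : Σ Set λ Y → Σ Set λ C → Σ (PFilter Y C) λ F →
    Deterministic F × SingleOutputting F × AllReachable F ×
    ((F⋆ : PFilter Y C) → MinDetSim F⋆ F → ¬ IsEquivalence (Induced F F⋆))
lemma4 = Observation , Colour , F , deterministic-F , single-outputting-F , all-reachable-F ,
  λ { F⋆ (deterministic-F⋆ , F⋆-simulates-F , minimal) equivalence →
        <-irrefl refl (≤-trans (at-least-five-states F⋆ deterministic-F⋆ F⋆-simulates-F equivalence)
                               (minimal G deterministic-G G-simulates-F)) }
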